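{- Let $G$ be an $(S_{1,2,5},S_{3,3,3})$-free chordal bipartite graph and let $D$ be an efficient dominating set of $G$ such that no vertex of $D$ is the midpoint (middle vertex) of an induced path $P_5$ in $G$. Then for every induced path $P_8$ $P=(u_1,v_1,u_2,v_2,u_3,v_3,u_4,v_4)$ in $G$, none of $u_1,u_2,v_2,u_3,v_3,v_4$ belongs to $D$.
   Context: All graphs are finite, simple and undirected. A set $D\subseteq V(G)$ is an efficient dominating set of $G$ if $|D\cap N[w]|=1$ for every vertex $w$, where $N[w]$ is the closed neighbourhood of $w$. For $i,j,k\ge0$, $S_{i,j,k}$ is the tree formed by a center $u$ and three induced paths from $u$ with $i$, $j$, $k$ further vertices respectively, pairwise sharing only $u$. A bipartite graph is chordal bipartite if it has no induced cycle $C_{2k}$ with $k\ge3$. -}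

module Defs where

open import Data.Nat using (ℕ; zero; suc; _+_; _*_; _≤_)
open import Data.Fin using (Fin; toℕ; _≟_)
open import Data.Fin.Subset using (Subset; _∩_; ∣_∣; _∈_)
open import Data.Bool using (Bool; true; false; _∨_; T)
open import Data.Vec using (tabulate)
open import Data.Product using (Σ; _×_; _,_; proj₁)
import Data.Fin as Fin
open import Data.Sum using (_⊎_)
open import Data.Empty using (⊥)
open import Relation.Nullary using (¬_)
open import Relation.Nullary.Decidable using (⌊_⌋)
open import Relation.Binary.PropositionalEquality using (_≡_; _≢_)
open import Function.Definitions using (Injective)

record Graph : Set where
  field
    n      : ℕ
    adj    : Fin n → Fin n → Bool
    sym    : ∀ x y → adj x y ≡ adj y x
    irrefl : ∀ x → adj x x ≡ false

open Graph public

Vertex : Graph → Set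
Vertex G = Fin (n G)

E : (G : Graph) → Vertex G → Vertex G → Set
E G x y = T (adj G x y)

N[_] : {G : Graph} → Vertex G → Subset (n G)
N[_] {G} w = tabulate (λ v → ⌊ v ≟ w ⌋ ∨ adj G w v)

EfficientDominating : (G : Graph) → Subset (n G) → Set
EfficientDominating G D = ∀ (w : Vertex G) → ∣ D ∩ N[_] {G} w ∣ ≡ 1

InducedCopy : {V : Set} → (V → V → Set) → Graph → Set
InducedCopy {V} H G =
  Σ (V → Vertex G) λ f →
    Injective _≡_ _≡_ f × (∀ a b → (H a b → E G (f a) (f b)) × (E G (f a) (f b) → H a b))

Free : {V : Set} → (V → V → Set) → Graph → Set
Free H G = ¬ InducedCopy H G

Consec : {m : ℕ} → Fin m → Fin m → Set
Consec a b = (suc (toℕ a) ≡ toℕ b) ⊎ (suc (toℕ b) ≡ toℕ a)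

PathAdj : (m : ℕ) → Fin m → Fin m → Set
PathAdj m a b = Consec a b

CycleAdj : (m : ℕ) → Fin m → Fin m → Set
CycleAdj m a b = Consec a b ⊎ ((toℕ a ≡ 0 × suc (toℕ b) ≡ m) ⊎ (toℕ b ≡ 0 × suc (toℕ a) ≡ m))

data SV (i j k : ℕ) : Set where
  ctr  : SV i j k
  leg1 : Fin i → SV i j k
  leg2 : Fin j → SV i j k
  leg3 : Fin k → SV i j k

SAdj : (i j k : ℕ) → SV i j k → SV i j k → Set
SAdj i j k ctr      ctr      = ⊥
SAdj i j k ctr      (leg1 b) = toℕ b ≡ 0
SAdj i j k ctr      (leg2 b) = toℕ b ≡ 0
SAdj i j k ctr      (leg3 b) = toℕ b ≡ 0
SAdj i j k (leg1 a) ctr      = toℕ a ≡ 0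
SAdj i j k (leg2 a) ctr      = toℕ a ≡ 0
SAdj i j k (leg3 a) ctr      = toℕ a ≡ 0
SAdj i j k (leg1 a) (leg1 b) = Consec a b
SAdj i j k (leg2 a) (leg2 b) = Consec a b
SAdj i j k (leg3 a) (leg3 b) = Consec a b
SAdj i j k (leg1 _) (leg2 _) = ⊥
SAdj i j k (leg1 _) (leg3 _) = ⊥
SAdj i j k (leg2 _) (leg1 _) = ⊥
SAdj i j k (leg2 _) (leg3 _) = ⊥
SAdj i j k (leg3 _) (leg1 _) = ⊥
SAdj i j k (leg3 _) (leg2 _) = ⊥

Bipartite : Graph → Set
Bipartite G = Σ (Vertex G → Bool) λ c → ∀ x y → E G x y → c x ≢ c y

ChordalBipartite : Graph → Set
ChordalBipartite G = Bipartite G × (∀ k → 3 ≤ k → ¬ InducedCopy (CycleAdj (2 * k)) G)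

MidpointOfP5 : (G : Graph) → Vertex G → Set
MidpointOfP5 G d = Σ (InducedCopy (PathAdj 5) G) λ P → proj₁ P (Fin.suc (Fin.suc Fin.zero)) ≡ d

{-# OPTIONS --safe #-}
-- Positions 2, …, 5 of the induced P₈ are midpoints of induced P₅'s inside it, so
-- they are not in D; by symmetry it remains to rule out u₁ ∈ D.  If u₁ ∈ D, the
-- vertex x ∈ D dominating u₂ is a neighbour of u₂ (as u₂ ∉ D) and, by
-- bipartiteness and independence of D, it is non-adjacent to every other vertex of
-- P except possibly u₃ and u₄.  If x ∼ u₃ then x is the midpoint of the induced P₅
-- (v₁, u₂, x, u₃, v₃); if x ∼ u₄ only, then (x, u₂, v₂, u₃, v₃, u₄) is an induced
-- C₆; otherwise x, u₂ and the two halves of P form an induced S_{1,2,5}.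
-- Each of these induced subgraphs is certified by an exhaustive check against the
-- adjacency table of P extended by x.  Positions 0, …, 7 of P are u₁, v₁, …, u₄, v₄.
module Submission where

open import Defs hiding (sym)
import Data.Bool as Bool
open import Data.Bool using (Bool; true; false; not; T)
open import Data.Bool.Properties using (¬-not; T-≡; T-∨)
open import Data.Fin using (Fin; zero; suc; toℕ; #_; _↑ʳ_; inject≤; opposite)

import Data.Fin.Properties as Fin
open import Data.Fin.Subset using (Subset; _∈_; _∉_; _∩_; ∣_∣; ⁅_⁆; _⊂_; Nonempty)
open import Data.Fin.Subset.Properties
  using (x∈p∩q⁺; x∈p∩q⁻; nonempty?; Empty-unique; ∣⊥∣≡0; x∈⁅y⁆⇒x≡y; ∣⁅x⁆∣≡1; p⊂q⇒∣p∣<∣q∣)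
open import Data.Nat using (_<_; s≤s; z≤n)
import Data.Nat as Nat
open import Data.Nat.Properties using (<-irrefl; +-monoˡ-≤)
import Data.Product as Product
open import Data.Product using (∃; _×_; _,_; proj₁; proj₂)
import Data.Sum as Sum
open import Data.Sum using (_⊎_; inj₁; inj₂; [_,_]; [_,_]′)
open import Data.Sum.Properties using (≡-dec)
open import Data.Unit using (⊤; tt)
import Data.Unit.Properties as Unit
open import Data.Vec using (_∷_; []; lookup; tabulate)
open import Data.Vec.Properties using (lookup∘tabulate; []=⇒lookup; lookup⇒[]=)
open import Function.Definitions using (Injective)
open import Function.Bundles using (module Equivalence)
open import Function using (_∘_; _$_; const)
open import Relation.Binary.Definitions using (DecidableEquality)
open import Relation.Binary.PropositionalEquality
  using (_≡_; refl; sym; trans; cong; subst; subst₂; ≢-sym)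
open import Relation.Nullary using (¬_; Dec; yes; no; proof; contradiction)
open import Relation.Nullary.Decidable
  using (⌊_⌋; True; toWitness; fromWitness; map′; _×-dec_; _⊎-dec_; _→-dec_; isYes≗does; dec-false; T?)
open import Relation.Nullary.Reflects using (fromEquivalence; det)

record Searchable (V : Set) : Set₁ where
  field
    all? : {P : V → Set} → (∀ v → Dec (P v)) → Dec (∀ v → P v)
    _≟_  : DecidableEquality V

open Searchable

⊤-searchable : Searchable ⊤
⊤-searchable = record { all? = λ P? → map′ (λ p _ → p) (_$ tt) (P? tt) ; _≟_ = Unit._≟_ }

Fin-searchable : ∀ {m} → Searchable (Fin m)
Fin-searchable = record { all? = Fin.all? ; _≟_ = Fin._≟_ }

⊎-searchable : ∀ {A B} → Searchable A → Searchable B → Searchable (A ⊎ B)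
⊎-searchable SA SB = record
  { all? = λ P? → map′ (λ (f , g) → [ f , g ]) (λ h → h ∘ inj₁ , h ∘ inj₂)
                       (all? SA (P? ∘ inj₁) ×-dec all? SB (P? ∘ inj₂))
  ; _≟_  = ≡-dec (_≟_ SA) (_≟_ SB)
  }

retract-searchable : ∀ {V W} (to : V → W) (from : W → V) → (∀ v → from (to v) ≡ v) →
                     Searchable W → Searchable V
retract-searchable to from from∘to SW = record
  { all? = λ {P} P? → map′ (λ h v → subst P (from∘to v) (h (to v))) (λ h → h ∘ from)
                           (all? SW (P? ∘ from))
  ; _≟_  = λ a b → map′ (λ e → trans (sym (from∘to a)) (trans (cong from e) (from∘to b)))
                        (cong to) (_≟_ SW (to a) (to b))
  }

SV-searchable : ∀ {i j k} → Searchable (SV i j k)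
SV-searchable {i} {j} {k} = retract-searchable to from from∘to
  (⊎-searchable ⊤-searchable (⊎-searchable Fin-searchable (⊎-searchable Fin-searchable Fin-searchable)))
  where
  to : SV i j k → ⊤ ⊎ (Fin i ⊎ (Fin j ⊎ Fin k))
  to ctr      = inj₁ tt
  to (leg1 a) = inj₂ (inj₁ a)
  to (leg2 a) = inj₂ (inj₂ (inj₁ a))
  to (leg3 a) = inj₂ (inj₂ (inj₂ a))
  from : ⊤ ⊎ (Fin i ⊎ (Fin j ⊎ Fin k)) → SV i j k
  from = [ const ctr , [ leg1 , [ leg2 , leg3 ]′ ]′ ]′
  from∘to : ∀ v → from (to v) ≡ v
  from∘to ctr      = refl
  from∘to (leg1 _) = refl
  from∘to (leg2 _) = refl
  from∘to (leg3 _) = refl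

consec? : ∀ {m} (a b : Fin m) → Dec (Consec a b)
consec? a b = (Nat.suc (toℕ a) Nat.≟ toℕ b) ⊎-dec (Nat.suc (toℕ b) Nat.≟ toℕ a)

cycle? : ∀ m (a b : Fin m) → Dec (CycleAdj m a b)
cycle? m a b = consec? a b ⊎-dec (((toℕ a Nat.≟ 0) ×-dec (Nat.suc (toℕ b) Nat.≟ m)) ⊎-dec
                                  ((toℕ b Nat.≟ 0) ×-dec (Nat.suc (toℕ a) Nat.≟ m)))

SAdj? : ∀ {i j k} (a b : SV i j k) → Dec (SAdj i j k a b)
SAdj? ctr      ctr      = no λ ()
SAdj? ctr      (leg1 b) = toℕ b Nat.≟ 0
SAdj? ctr      (leg2 b) = toℕ b Nat.≟ 0
SAdj? ctr      (leg3 b) = toℕ b Nat.≟ 0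
SAdj? (leg1 a) ctr      = toℕ a Nat.≟ 0
SAdj? (leg2 a) ctr      = toℕ a Nat.≟ 0
SAdj? (leg3 a) ctr      = toℕ a Nat.≟ 0
SAdj? (leg1 a) (leg1 b) = consec? a b
SAdj? (leg2 a) (leg2 b) = consec? a b
SAdj? (leg3 a) (leg3 b) = consec? a b
SAdj? (leg1 _) (leg2 _) = no λ ()
SAdj? (leg1 _) (leg3 _) = no λ ()
SAdj? (leg2 _) (leg1 _) = no λ ()
SAdj? (leg2 _) (leg3 _) = no λ ()
SAdj? (leg3 _) (leg1 _) = no λ ()
SAdj? (leg3 _) (leg2 _) = no λ ()

record Realises (G : Graph) {I : Set} (w : I → Vertex G) (K : I → I → Bool) : Set where
  constructor realises
  field adj≡ : ∀ i j → adj G (w i) (w j) ≡ K i j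

open Realises

TwinFree : {V : Set} {H : V → V → Set} → (∀ a b → Dec (H a b)) → Set
TwinFree H? = ∀ a b → (∀ c → ⌊ H? a c ⌋ ≡ ⌊ H? b c ⌋) → a ≡ b

twinFree? : {V : Set} {H : V → V → Set} → Searchable V → (H? : ∀ a b → Dec (H a b)) →
            Dec (TwinFree H?)
twinFree? S H? = all? S λ a → all? S λ b →
  all? S (λ c → ⌊ H? a c ⌋ Bool.≟ ⌊ H? b c ⌋) →-dec _≟_ S a b

reflects⇒≡⌊⌋ : {A : Set} {b : Bool} (a? : Dec A) → (T b → A) → (A → T b) → b ≡ ⌊ a? ⌋
reflects⇒≡⌊⌋ a? sound complete =
  trans (det (fromEquivalence sound complete) (proof a?)) (sym (isYes≗does a?))

copy-realises : ∀ {G V} {H : V → V → Set} (H? : ∀ a b → Dec (H a b)) (P : InducedCopy H G) →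
                Realises G (proj₁ P) (λ a b → ⌊ H? a b ⌋)
copy-realises H? (_ , _ , adj⇔H) = realises λ a b →
  reflects⇒≡⌊⌋ (H? a b) (proj₂ (adj⇔H a b)) (proj₁ (adj⇔H a b))

module _ {G : Graph} {I : Set} {w : I → Vertex G} {K : I → I → Bool} (w-realises-K : Realises G w K)
         {V : Set} {H : V → V → Set} (H? : ∀ a b → Dec (H a b)) (σ : V → I) where

  realised-copy : (∀ a b → K (σ a) (σ b) ≡ ⌊ H? a b ⌋) → TwinFree H? → InducedCopy H G
  realised-copy K∘σ≡H twinFree =
    w ∘ σ , injective , λ a b → (λ h → subst T (sym (adj≡H a b)) (fromWitness h))
                              , (λ e → toWitness (subst T (adj≡H a b) e))
    where
    adj≡H : ∀ a b → adj G (w (σ a)) (w (σ b)) ≡ ⌊ H? a b ⌋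
    adj≡H a b = trans (adj≡ w-realises-K (σ a) (σ b)) (K∘σ≡H a b)
    -- equal images have equal adjacency rows, and twin-freeness separates distinct rows
    injective : Injective _≡_ _≡_ (w ∘ σ)
    injective {a} {b} e = twinFree a b λ c →
      trans (sym (adj≡H a c)) (trans (cong (λ v → adj G v (w (σ c))) e) (adj≡H b c))

  realised-copy-by-search :
    (S : Searchable V) →
    {_ : True (all? S λ a → all? S λ b → K (σ a) (σ b) Bool.≟ ⌊ H? a b ⌋)} →
    {_ : True (twinFree? S H?)} →
    InducedCopy H G
  realised-copy-by-search S {matches} {twinFree} =
    realised-copy (λ a b → toWitness matches a b) (toWitness twinFree)

_▷_ : {I : Set} → (I → I → Bool) → (I → Bool) → I ⊎ ⊤ → I ⊎ ⊤ → Bool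
(K ▷ r) (inj₁ i) (inj₁ j) = K i j
(K ▷ r) (inj₁ i) (inj₂ _) = r i
(K ▷ r) (inj₂ _) (inj₁ j) = r j
(K ▷ r) (inj₂ _) (inj₂ _) = false

extend-realises : ∀ {G I} {w : I → Vertex G} {K : I → I → Bool} {x : Vertex G} {r : I → Bool} →
                  Realises G w K → (∀ i → adj G (w i) x ≡ r i) →
                  Realises G [ w , const x ]′ (K ▷ r)
extend-realises {G} {w = w} {x = x} w-realises-K row = realises adj≡▷
  where
  adj≡▷ : ∀ i j → adj G ([ w , const x ]′ i) ([ w , const x ]′ j) ≡ _
  adj≡▷ (inj₁ i) (inj₁ j) = adj≡ w-realises-K i j
  adj≡▷ (inj₁ i) (inj₂ _) = row i
  adj≡▷ (inj₂ _) (inj₁ j) = trans (Graph.sym G x (w j)) (row j)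
  adj≡▷ (inj₂ _) (inj₂ _) = irrefl G x

∈tabulate⁺ : ∀ {m} {f : Fin m → Bool} {x} → T (f x) → x ∈ tabulate f
∈tabulate⁺ {f = f} {x} fx = lookup⇒[]= x _ (trans (lookup∘tabulate f x) (Equivalence.to T-≡ fx))

∈tabulate⁻ : ∀ {m} {f : Fin m → Bool} {x} → x ∈ tabulate f → T (f x)
∈tabulate⁻ {f = f} {x} x∈ = Equivalence.from T-≡ (trans (sym (lookup∘tabulate f x)) ([]=⇒lookup x∈))

∣p∣≡1⇒nonempty : ∀ {m} {p : Subset m} → ∣ p ∣ ≡ 1 → Nonempty p
∣p∣≡1⇒nonempty {m} {p} ∣p∣≡1 with nonempty? p
... | yes p≢∅ = p≢∅
... | no  p≡∅ = contradiction (trans (sym ∣p∣≡1) (trans (cong ∣_∣ (Empty-unique p≡∅)) (∣⊥∣≡0 m))) λ ()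

∣p∣≡1⇒x≡y : ∀ {m} {p : Subset m} {x y} → ∣ p ∣ ≡ 1 → x ∈ p → y ∈ p → x ≡ y
∣p∣≡1⇒x≡y {p = p} {x} {y} ∣p∣≡1 x∈p y∈p with x Fin.≟ y
... | yes x≡y = x≡y
... | no  x≢y = contradiction (subst₂ _<_ (∣⁅x⁆∣≡1 x) ∣p∣≡1 (p⊂q⇒∣p∣<∣q∣ ⁅x⁆⊂p)) (<-irrefl refl)
  where
  ⁅x⁆⊂p : ⁅ x ⁆ ⊂ p
  ⁅x⁆⊂p = (λ z∈⁅x⁆ → subst (_∈ p) (sym (x∈⁅y⁆⇒x≡y x z∈⁅x⁆)) x∈p)
        , y , y∈p , x≢y ∘ sym ∘ x∈⁅y⁆⇒x≡y x

module _ {G : Graph} where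

  ∈N[]⁺ : ∀ {w y} → y ≡ w ⊎ E G w y → y ∈ N[_] {G} w
  ∈N[]⁺ y≡w⊎w∼y = ∈tabulate⁺ (Equivalence.from T-∨ (Sum.map₁ fromWitness y≡w⊎w∼y))

  ∈N[]⁻ : ∀ {w y} → y ∈ N[_] {G} w → y ≡ w ⊎ E G w y
  ∈N[]⁻ y∈N[w] = Sum.map₁ toWitness (Equivalence.to T-∨ (∈tabulate⁻ y∈N[w]))

  module _ {D : Subset (n G)} (efficient : EfficientDominating G D) where

    dominator : ∀ w → ∃ λ x → x ∈ D × (x ≡ w ⊎ E G w x)
    dominator w with ∣p∣≡1⇒nonempty (efficient w)
    ... | x , x∈D∩N[w] = x , Product.map₂ ∈N[]⁻ (x∈p∩q⁻ D _ x∈D∩N[w])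

    D-independent : ∀ {d d′} → d ∈ D → d′ ∈ D → ¬ E G d d′
    D-independent {d} {d′} d∈D d′∈D d∼d′ = subst T (irrefl G d) (subst (E G d) (sym d≡d′) d∼d′)
      where
      d≡d′ : d ≡ d′
      d≡d′ = ∣p∣≡1⇒x≡y (efficient d) (x∈p∩q⁺ (d∈D , ∈N[]⁺ (inj₁ refl))) (x∈p∩q⁺ (d′∈D , ∈N[]⁺ (inj₂ d∼d′)))

path-table : ∀ {m} → Fin m → Fin m → Bool
path-table a b = ⌊ consec? a b ⌋

reverse-path : ∀ {G} → InducedCopy (PathAdj 8) G → InducedCopy (PathAdj 8) G
reverse-path {G} P = realised-copy-by-search (copy-realises {G} consec? P) consec? opposite Fin-searchable

window : Fin 4 → Fin 5 → Fin 8
window k a = inject≤ (toℕ k ↑ʳ a) (+-monoˡ-≤ 5 (Fin.toℕ≤pred[n] k))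

-- The search only evaluates on a concrete window, hence one clause per window.
window-midpoint : ∀ {G} (P : InducedCopy (PathAdj 8) G) (k : Fin 4) →
                  MidpointOfP5 G (proj₁ P (window k (# 2)))
window-midpoint {G} P k@zero                   =
  realised-copy-by-search (copy-realises {G} consec? P) consec? (window k) Fin-searchable , refl
window-midpoint {G} P k@(suc zero)             =
  realised-copy-by-search (copy-realises {G} consec? P) consec? (window k) Fin-searchable , refl
window-midpoint {G} P k@(suc (suc zero))       =
  realised-copy-by-search (copy-realises {G} consec? P) consec? (window k) Fin-searchable , refl
window-midpoint {G} P k@(suc (suc (suc zero))) =
  realised-copy-by-search (copy-realises {G} consec? P) consec? (window k) Fin-searchable , refl

module Colouring {G : Graph} (bipartite : Bipartite G) where

  colour : Vertex G → Bool
  colour = proj₁ bipartite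

  common-neighbour⇒same-colour : ∀ {u v w} → E G v u → E G v w → colour u ≡ colour w
  common-neighbour⇒same-colour {u} {v} {w} v∼u v∼w =
    trans (¬-not (≢-sym (proj₂ bipartite v u v∼u))) (sym (¬-not (≢-sym (proj₂ bipartite v w v∼w))))

  same-colour⇒nonadjacent : ∀ {u v} → colour u ≡ colour v → adj G u v ≡ false
  same-colour⇒nonadjacent {u} {v} same = dec-false (T? (adj G u v)) λ u∼v → proj₂ bipartite u v u∼v same

attachment : Bool → Bool → Fin 8 → Bool
attachment x₄ x₆ = lookup (false ∷ false ∷ true ∷ false ∷ x₄ ∷ false ∷ x₆ ∷ false ∷ [])

P₅-through-x : Fin 5 → Fin 8 ⊎ ⊤
P₅-through-x = lookup (inj₁ (# 1) ∷ inj₁ (# 2) ∷ inj₂ tt ∷ inj₁ (# 4) ∷ inj₁ (# 5) ∷ [])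

C₆-through-x : Fin 6 → Fin 8 ⊎ ⊤
C₆-through-x = lookup (inj₂ tt ∷ inj₁ (# 2) ∷ inj₁ (# 3) ∷ inj₁ (# 4) ∷ inj₁ (# 5) ∷ inj₁ (# 6) ∷ [])

S₁₂₅-through-x : SV 1 2 5 → Fin 8 ⊎ ⊤
S₁₂₅-through-x ctr      = inj₁ (# 2)
S₁₂₅-through-x (leg1 _) = inj₂ tt
S₁₂₅-through-x (leg2 a) = inj₁ (lookup (# 1 ∷ # 0 ∷ []) a)
S₁₂₅-through-x (leg3 a) = inj₁ (lookup (# 3 ∷ # 4 ∷ # 5 ∷ # 6 ∷ # 7 ∷ []) a)

module _ {G : Graph} (s125-free : Free (SAdj 1 2 5) G) (chordal : ChordalBipartite G)
         {D : Subset (n G)} (efficient : EfficientDominating G D)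
         (no-midpoint : ∀ d → d ∈ D → ¬ MidpointOfP5 G d) (P : InducedCopy (PathAdj 8) G) where

  private
    p : Fin 8 → Vertex G
    p = proj₁ P

    edge : ∀ a b → Consec a b → E G (p a) (p b)
    edge a b = proj₁ (proj₂ (proj₂ P) a b)

    open Colouring {G} (proj₁ chordal)

  attached-vertex∉D : ∀ {x} b₄ b₆ → Realises G [ p , const x ]′ (path-table ▷ attachment b₄ b₆) →
                      x ∉ D
  attached-vertex∉D true  _     r x∈D =
    no-midpoint _ x∈D (realised-copy-by-search r consec? P₅-through-x Fin-searchable , refl)
  attached-vertex∉D false true  r _   =
    proj₂ chordal 3 (s≤s (s≤s (s≤s z≤n))) (realised-copy-by-search r (cycle? 6) C₆-through-x Fin-searchable)
  attached-vertex∉D false false r _   =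
    s125-free (realised-copy-by-search r SAdj? S₁₂₅-through-x SV-searchable)

  attachment-row : ∀ {x} → p zero ∈ D → x ∈ D → E G (p (# 2)) x →
                   ∀ a → adj G (p a) x ≡ attachment (adj G (p (# 4)) x) (adj G (p (# 6)) x) a
  attachment-row {x} p₀∈D x∈D u₂∼x = row
    where
    c₁ : colour (p (# 1)) ≡ colour x
    c₁ = common-neighbour⇒same-colour (edge (# 2) (# 1) (inj₂ refl)) u₂∼x
    c₃ : colour (p (# 3)) ≡ colour x
    c₃ = common-neighbour⇒same-colour (edge (# 2) (# 3) (inj₁ refl)) u₂∼x
    c₅ : colour (p (# 5)) ≡ colour x
    c₅ = trans (common-neighbour⇒same-colour (edge (# 4) (# 5) (inj₁ refl)) (edge (# 4) (# 3) (inj₂ refl)))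
               c₃
    c₇ : colour (p (# 7)) ≡ colour x
    c₇ = trans (common-neighbour⇒same-colour (edge (# 6) (# 7) (inj₁ refl)) (edge (# 6) (# 5) (inj₂ refl)))
               c₅
    row : ∀ a → adj G (p a) x ≡ attachment (adj G (p (# 4)) x) (adj G (p (# 6)) x) a
    row zero = dec-false (T? _) (D-independent {G} efficient p₀∈D x∈D)
    row (suc zero) = same-colour⇒nonadjacent c₁
    row (suc (suc zero)) = Equivalence.to T-≡ u₂∼x
    row (suc (suc (suc zero))) = same-colour⇒nonadjacent c₃
    row (suc (suc (suc (suc zero)))) = refl
    row (suc (suc (suc (suc (suc zero))))) = same-colour⇒nonadjacent c₅
    row (suc (suc (suc (suc (suc (suc zero)))))) = refl
    row (suc (suc (suc (suc (suc (suc (suc zero))))))) = same-colour⇒nonadjacent c₇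

  first-vertex∉D : p zero ∉ D
  first-vertex∉D p₀∈D with dominator {G} efficient (p (# 2))
  ... | x , x∈D , inj₁ x≡u₂ = no-midpoint _ (subst (_∈ D) x≡u₂ x∈D) (window-midpoint {G} P zero)
  ... | x , x∈D , inj₂ u₂∼x =
    attached-vertex∉D _ _ (extend-realises (copy-realises {G} consec? P) (attachment-row p₀∈D x∈D u₂∼x)) x∈D

lemma8 : (G : Graph) → Free (SAdj 1 2 5) G → Free (SAdj 3 3 3) G → ChordalBipartite G →
    (D : Subset (n G)) → EfficientDominating G D →
    (∀ d → d ∈ D → ¬ MidpointOfP5 G d) →
    (P : InducedCopy (PathAdj 8) G) →
    let p = proj₁ P in
    p zero ∉ D × p (suc (suc zero)) ∉ D × p (suc (suc (suc zero))) ∉ D ×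
    p (suc (suc (suc (suc zero)))) ∉ D × p (suc (suc (suc (suc (suc zero))))) ∉ D ×
    p (suc (suc (suc (suc (suc (suc (suc zero))))))) ∉ D
lemma8 G s125-free _ chordal D efficient no-midpoint P =
  first∉D P , interior∉D (# 0) , interior∉D (# 1) , interior∉D (# 2) , interior∉D (# 3) ,
  first∉D (reverse-path {G} P)
  where
  first∉D : (Q : InducedCopy (PathAdj 8) G) → proj₁ Q zero ∉ D
  first∉D = first-vertex∉D {G} s125-free chordal efficient no-midpoint
  interior∉D : (k : Fin 4) → proj₁ P (window k (# 2)) ∉ D
  interior∉D k d∈D = no-midpoint _ d∈D (window-midpoint {G} P k)
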